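{- Let $\mathrm{N}(f_n)$ denote the number of pairwise nonisomorphic leaf-induced subtrees of the leaf-Fibonacci tree $f_n$. Then $\mathrm{N}(f_0)=1$, $\mathrm{N}(f_1)=2$, and for all $n\ge 2$, $$\mathrm{N}(f_n)=1+\tfrac12\mathrm{N}(f_{n-2})-\tfrac12\mathrm{N}(f_{n-2})^2+\mathrm{N}(f_{n-2})\,\mathrm{N}(f_{n-1}).$$
   Context: A topological tree is a rooted tree with no vertex of outdegree $1$. The leaf-Fibonacci trees are defined recursively: $f_0$ is the tree with a single vertex; $f_1$ is the tree consisting of a root with two leaves attached; for $n\ge 2$, $f_n$ is obtained by joining the roots of $f_{n-1}$ and $f_{n-2}$ to a new common root vertex. For a topological tree $T$ and a nonempty set $L$ of leaves of $T$, the subtree induced by $L$ is obtained by taking the minimal subtree of $T$ containing all leaves in $L$ (rooted at its vertex closest to the root of $T$) and suppressing all vertices of outdegree $1$; such trees are called leaf-induced subtrees of $T$ (the one-vertex tree, induced by a single leaf, is included). Two rooted trees are isomorphic if there is a graph isomorphism between them mapping root to root; $\mathrm{N}(T)$ counts leaf-induced subtrees of $T$ up to isomorphism. -}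

module Defs where

open import Data.Nat using (ℕ; zero; suc)
open import Data.Bool using (Bool; true; false)
open import Data.List using (List; []; _∷_; length)
open import Data.List.Relation.Unary.All using (All; []; _∷_)
open import Data.List.Relation.Unary.Any using (Any)
open import Data.List.Relation.Unary.AllPairs using (AllPairs)
open import Data.List.Relation.Binary.Permutation.Propositional using (_↭_)
open import Data.Maybe using (Maybe; just; nothing)
open import Data.Product using (Σ; _×_; ∃)
open import Relation.Binary.PropositionalEquality using (_≡_)
open import Relation.Nullary using (¬_)

-- Rooted trees with unordered children (children stored in a list; order
-- is irrelevant up to the isomorphism relation below).  A leaf is node [].
data Tree : Set where
  node : List Tree → Tree

leaf : Tree
leaf = node []

data Topological : Tree → Set where
  topo : ∀ {ts} → ¬ (length ts ≡ 1) → All Topological ts → Topological (node ts)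

mutual
  data _≅_ : Tree → Tree → Set where
    iso : ∀ {xs ys zs} → xs ↭ zs → PW zs ys → node xs ≅ node ys

  data PW : List Tree → List Tree → Set where
    []  : PW [] []
    _∷_ : ∀ {x y xs ys} → x ≅ y → PW xs ys → PW (x ∷ xs) (y ∷ ys)

data LeafSet : Tree → Set where
  mark : Bool → LeafSet leaf
  sub  : ∀ {t ts} → All LeafSet (t ∷ ts) → LeafSet (node (t ∷ ts))

-- Subtree induced by a leaf set (nothing if the set is empty):
-- minimal subtree containing the marked leaves, with vertices of
-- outdegree 1 suppressed.
mutual
  induce : (t : Tree) → LeafSet t → Maybe Tree
  induce .(node []) (mark true)  = just leaf
  induce .(node []) (mark false) = nothing
  induce (node (t ∷ ts)) (sub ss) with induceAll (t ∷ ts) ss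
  ... | []          = nothing
  ... | u ∷ []      = just u
  ... | u ∷ v ∷ us  = just (node (u ∷ v ∷ us))

  induceAll : (ts : List Tree) → All LeafSet ts → List Tree
  induceAll [] [] = []
  induceAll (t ∷ ts) (s ∷ ss) with induce t s
  ... | nothing = induceAll ts ss
  ... | just u  = u ∷ induceAll ts ss

LeafInduced : Tree → Tree → Set
LeafInduced T u = Σ (LeafSet T) (λ L → induce T L ≡ just u)

-- NumClasses T k : the leaf-induced subtrees of T fall into exactly k
-- isomorphism classes, witnessed by k pairwise nonisomorphic
-- representatives covering all classes.  (So N(T) = k.)
NumClasses : Tree → ℕ → Set
NumClasses T k =
  Σ (List Tree) λ reps →
    (length reps ≡ k) ×
    All (LeafInduced T) reps ×
    AllPairs (λ a b → ¬ (a ≅ b)) reps ×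
    (∀ u → LeafInduced T u → Any (u ≅_) reps)

fib : ℕ → Tree
fib zero = leaf
fib (suc zero) = node (leaf ∷ leaf ∷ [])
fib (suc (suc n)) = node (fib (suc n) ∷ fib n ∷ [])

-- A leaf-induced subtree of f (n+2) = branch (f (n+1)) (f n) is a leaf-induced
-- subtree of one half, or a branch of one from each half. Every leaf-induced
-- subtree of f n is one of f (n+1), and those of f (n+1) are leaves or such
-- branches themselves, so the classes of f (n+2) are the leaf together with the
-- branches on unordered pairs {x, y}, x a class of f (n+1) and y one of f n;
-- two such branches are isomorphic only when their pairs agree. Of these pairs
-- the N(f n)(N(f n) + 1)/2 with both entries among the classes of f n are counted
-- once, and each of the remaining (N(f (n+1)) - N(f n)) N(f n) once, giving
-- N(f (n+2)) = 1 + N(f n)(N(f n) + 1)/2 + (N(f (n+1)) - N(f n)) N(f n).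

module Submission where

open import Defs
open import Data.Nat using (ℕ; zero; suc; _+_; _*_)
open import Data.Product using (Σ; _×_; _,_; proj₁; proj₂; ∃₂)
open import Data.Sum using (_⊎_; inj₁; inj₂; [_,_])
import Data.Sum as Sum
open import Data.Bool using (true; false)
open import Data.Maybe using (Maybe; just; nothing)
open import Data.List using (List; []; _∷_; _++_; map; length; cartesianProductWith)
open import Data.List.Properties using (length-++; length-map)
open import Data.List.Relation.Unary.All as All using (All; []; _∷_)
open import Data.List.Relation.Unary.All.Properties using () renaming (map⁺ to All-map⁺; ++⁺ to All-++⁺)
open import Data.List.Relation.Unary.Any using (Any; here; there)
open import Data.List.Relation.Unary.Any.Properties using (++⁺ˡ)
open import Data.List.Relation.Unary.AllPairs as AllPairs using (AllPairs; []; _∷_)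
import Data.List.Relation.Unary.AllPairs.Properties as AllPairs
open import Data.List.Membership.Propositional using (_∈_; find; lose)
open import Data.List.Membership.Propositional.Properties
  using (∈-++⁺ˡ; ∈-++⁺ʳ; ∈-++⁻; ∈-map⁺; ∈-map⁻; ∈-cartesianProductWith⁺; ∈-cartesianProductWith⁻)
open import Data.List.Relation.Binary.Permutation.Propositional using (_↭_; ↭-refl; ↭-sym; ↭-swap; ↭-trans)
open import Data.List.Relation.Binary.Permutation.Propositional.Properties
  using (↭-length; drop-∷; ∈-resp-↭; ↭-empty-inv; ↭-singleton-inv)
open import Relation.Nullary using (¬_)
open import Relation.Binary.PropositionalEquality using (_≡_; refl; trans; cong; cong₂; module ≡-Reasoning)
open import Data.Nat.Tactic.RingSolver using (solve-∀)

branch : Tree → Tree → Tree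
branch a b = node (a ∷ b ∷ [])

cherry : Tree
cherry = branch leaf leaf

mutual
  ≅-refl : ∀ t → t ≅ t
  ≅-refl (node ts) = iso ↭-refl (PW-refl ts)

  PW-refl : ∀ ts → PW ts ts
  PW-refl []       = []
  PW-refl (t ∷ ts) = ≅-refl t ∷ PW-refl ts

branch-≅ : ∀ {a b c d} → a ≅ c → b ≅ d → branch a b ≅ branch c d
branch-≅ a≅c b≅d = iso ↭-refl (a≅c ∷ b≅d ∷ [])

branch-≅-swap : ∀ {a b c d} → a ≅ d → b ≅ c → branch a b ≅ branch c d
branch-≅-swap {a} {b} a≅d b≅c = iso (↭-swap a b ↭-refl) (b≅c ∷ a≅d ∷ [])

↭-pair-inv : ∀ {A : Set} {a b : A} {zs} → a ∷ b ∷ [] ↭ zs →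
             zs ≡ a ∷ b ∷ [] ⊎ zs ≡ b ∷ a ∷ []
↭-pair-inv {zs = []}              p with () ← ↭-length p
↭-pair-inv {zs = _ ∷ []}          p with () ← ↭-length p
↭-pair-inv {zs = _ ∷ _ ∷ _ ∷ _}   p with () ← ↭-length p
↭-pair-inv {a = a} {zs = c ∷ d ∷ []} p with ∈-resp-↭ p (here refl)
... | here refl with refl ← ↭-singleton-inv (drop-∷ p) = inj₁ refl
... | there (here refl)
      with refl ← ↭-singleton-inv (drop-∷ (↭-trans p (↭-swap c a ↭-refl))) = inj₂ refl

branch-≅-inv : ∀ {a b c d} → branch a b ≅ branch c d → (a ≅ c × b ≅ d) ⊎ (a ≅ d × b ≅ c)
branch-≅-inv (iso p q) with ↭-pair-inv p
branch-≅-inv (iso p (a≅c ∷ b≅d ∷ [])) | inj₁ refl = inj₁ (a≅c , b≅d)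
branch-≅-inv (iso p (b≅c ∷ a≅d ∷ [])) | inj₂ refl = inj₂ (a≅d , b≅c)

leaf≇branch : ∀ {a b} → ¬ leaf ≅ branch a b
leaf≇branch (iso p q) with refl ← ↭-empty-inv (↭-sym p) with () ← q

branch≇leaf : ∀ {a b} → ¬ branch a b ≅ leaf
branch≇leaf (iso p []) with () ← ↭-length p

-- Isomorphism is not shown to be symmetric, so apartness excludes both directions.
_#_ : Tree → Tree → Set
a # b = ¬ a ≅ b × ¬ b ≅ a

#-sym : ∀ {a b} → a # b → b # a
#-sym (a≇b , b≇a) = b≇a , a≇b

leaf#branch : ∀ {a b} → leaf # branch a b
leaf#branch = leaf≇branch , branch≇leaf

#-branch : ∀ {a b c d} → a # c ⊎ b # d → a # d ⊎ b # c → branch a b # branch c d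
#-branch {a} {b} {c} {d} straight crossed = to , from
  where
  to : ¬ branch a b ≅ branch c d
  to e with branch-≅-inv e
  ... | inj₁ (a≅c , b≅d) = [ (λ a#c → proj₁ a#c a≅c) , (λ b#d → proj₁ b#d b≅d) ] straight
  ... | inj₂ (a≅d , b≅c) = [ (λ a#d → proj₁ a#d a≅d) , (λ b#c → proj₁ b#c b≅c) ] crossed
  from : ¬ branch c d ≅ branch a b
  from e with branch-≅-inv e
  ... | inj₁ (c≅a , d≅b) = [ (λ a#c → proj₂ a#c c≅a) , (λ b#d → proj₂ b#d d≅b) ] straight
  ... | inj₂ (c≅b , d≅a) = [ (λ a#d → proj₂ a#d d≅a) , (λ b#c → proj₂ b#c c≅b) ] crossed

#-branchˡ : ∀ {a b c d} → a # c → a # d → branch a b # branch c d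
#-branchˡ a#c a#d = #-branch (inj₁ a#c) (inj₁ a#d)

#-branchʳ : ∀ {a b c d} → b # c → b # d → branch a b # branch c d
#-branchʳ b#c b#d = #-branch (inj₂ b#d) (inj₂ b#c)

module _ {A : Set} {R : A → A → Set} where

  AllPairs-++⁺ : ∀ {xs ys} → AllPairs R xs → AllPairs R ys →
                 (∀ {x y} → x ∈ xs → y ∈ ys → R x y) → AllPairs R (xs ++ ys)
  AllPairs-++⁺ Rxs Rys across =
    AllPairs.++⁺ Rxs Rys (All.tabulate λ x∈ → All.tabulate λ y∈ → across x∈ y∈)

  AllPairs-++⁻ʳ : ∀ xs {ys} → AllPairs R (xs ++ ys) → AllPairs R ys
  AllPairs-++⁻ʳ []       Rys          = Rys
  AllPairs-++⁻ʳ (_ ∷ xs) (_ ∷ Rxs++ys) = AllPairs-++⁻ʳ xs Rxs++ys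

  AllPairs-++⁻-across : ∀ xs {ys} → AllPairs R (xs ++ ys) → ∀ {x y} → x ∈ xs → y ∈ ys → R x y
  AllPairs-++⁻-across (_ ∷ xs) (Rx ∷ _)       (here refl) y∈ = All.lookup Rx (∈-++⁺ʳ xs y∈)
  AllPairs-++⁻-across (_ ∷ xs) (_ ∷ Rxs++ys) (there x∈)  y∈ = AllPairs-++⁻-across xs Rxs++ys x∈ y∈

Distinct : List Tree → Set
Distinct = AllPairs _#_

Distinct-map-branch : ∀ {a M} → All (a #_) M → Distinct M → Distinct (map (branch a) M)
Distinct-map-branch []          []          = []
Distinct-map-branch (_ ∷ a#M) (b#M ∷ dM) =
  All-map⁺ (All.zipWith (λ (b#c , a#c) → #-branch (inj₂ b#c) (inj₁ a#c)) (b#M , a#M))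
  ∷ Distinct-map-branch a#M dM

Distinct-cartesian : ∀ L {M} → Distinct L → Distinct M → (∀ {a b} → a ∈ L → b ∈ M → a # b) →
                     Distinct (cartesianProductWith branch L M)
Distinct-cartesian []      _           _  _   = []
Distinct-cartesian (a ∷ L) {M} (a#L ∷ dL) dM L#M =
  AllPairs-++⁺ (Distinct-map-branch (All.tabulate (L#M (here refl))) dM)
               (Distinct-cartesian L dL dM (λ a′∈ → L#M (there a′∈)))
               across
  where
  across : ∀ {x y} → x ∈ map (branch a) M → y ∈ cartesianProductWith branch L M → x # y
  across x∈ y∈ with ∈-map⁻ (branch a) x∈ | ∈-cartesianProductWith⁻ branch L M y∈
  ... | _ , _ , refl | _ , _ , a′∈ , b′∈ , refl = #-branchˡ (All.lookup a#L a′∈) (L#M (here refl) b′∈)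

triangle : List Tree → List Tree
triangle []      = []
triangle (a ∷ L) = map (branch a) (a ∷ L) ++ triangle L

∈-triangle⁻ : ∀ L {x} → x ∈ triangle L → ∃₂ λ a b → a ∈ L × b ∈ L × x ≡ branch a b
∈-triangle⁻ (a ∷ L) x∈ with ∈-++⁻ (map (branch a) (a ∷ L)) x∈
... | inj₁ x∈map with ∈-map⁻ (branch a) x∈map
...   | b , b∈ , refl = a , b , here refl , b∈ , refl
∈-triangle⁻ (a ∷ L) x∈ | inj₂ x∈tri with ∈-triangle⁻ L x∈tri
...   | a′ , b , a′∈ , b∈ , refl = a′ , b , there a′∈ , there b∈ , refl

∈-triangle⁺ : ∀ L {a b} → a ∈ L → b ∈ L → branch a b ∈ triangle L ⊎ branch b a ∈ triangle L
∈-triangle⁺ (c ∷ L) (here refl) b∈          = inj₁ (∈-++⁺ˡ (∈-map⁺ (branch c) b∈))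
∈-triangle⁺ (c ∷ L) (there a∈)  (here refl) = inj₂ (∈-++⁺ˡ (∈-map⁺ (branch c) (there a∈)))
∈-triangle⁺ (c ∷ L) (there a∈)  (there b∈)  =
  Sum.map (∈-++⁺ʳ (map (branch c) (c ∷ L))) (∈-++⁺ʳ (map (branch c) (c ∷ L))) (∈-triangle⁺ L a∈ b∈)

Distinct-triangle : ∀ L → Distinct L → Distinct (triangle L)
Distinct-triangle []      []          = []
Distinct-triangle (a ∷ L) (a#L ∷ dL) =
  AllPairs-++⁺ (All.tabulate diagonal ∷ Distinct-map-branch a#L dL) (Distinct-triangle L dL) across
  where
  diagonal : ∀ {y} → y ∈ map (branch a) L → branch a a # y
  diagonal y∈ with ∈-map⁻ (branch a) y∈
  ... | b , b∈ , refl = #-branch (inj₂ (All.lookup a#L b∈)) (inj₁ (All.lookup a#L b∈))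
  across : ∀ {x y} → x ∈ map (branch a) (a ∷ L) → y ∈ triangle L → x # y
  across x∈ y∈ with ∈-map⁻ (branch a) x∈ | ∈-triangle⁻ L y∈
  ... | _ , _ , refl | _ , _ , c∈ , d∈ , refl = #-branchˡ (All.lookup a#L c∈) (All.lookup a#L d∈)

length-cartesianProductWith : ∀ {A B C : Set} (f : A → B → C) xs ys →
                              length (cartesianProductWith f xs ys) ≡ length xs * length ys
length-cartesianProductWith f []       ys = refl
length-cartesianProductWith f (x ∷ xs) ys =
  trans (length-++ (map (f x) ys))
        (cong₂ _+_ (length-map (f x) ys) (length-cartesianProductWith f xs ys))

length-triangle : ∀ L → 2 * length (triangle L) ≡ length L * suc (length L)
length-triangle []      = refl
length-triangle (a ∷ L) = begin
    2 * length (map (branch a) (a ∷ L) ++ triangle L)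
  ≡⟨ cong (2 *_) (trans (length-++ (map (branch a) (a ∷ L)))
                        (cong (_+ length (triangle L)) (length-map (branch a) (a ∷ L)))) ⟩
    2 * (suc l + length (triangle L))
  ≡⟨ distrib l (length (triangle L)) ⟩
    2 * suc l + 2 * length (triangle L)
  ≡⟨ cong (2 * suc l +_) (length-triangle L) ⟩
    2 * suc l + l * suc l
  ≡⟨ factor l ⟩
    suc l * suc (suc l) ∎
  where
  open ≡-Reasoning
  l : ℕ
  l = length L
  distrib : ∀ m k → 2 * (suc m + k) ≡ 2 * suc m + 2 * k
  distrib = solve-∀
  factor : ∀ m → 2 * suc m + m * suc m ≡ suc m * suc (suc m)
  factor = solve-∀

mutual
  noLeaves : ∀ t → LeafSet t
  noLeaves (node [])       = mark false
  noLeaves (node (t ∷ ts)) = sub (noLeavesAll (t ∷ ts))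

  noLeavesAll : ∀ ts → All LeafSet ts
  noLeavesAll []       = []
  noLeavesAll (t ∷ ts) = noLeaves t ∷ noLeavesAll ts

mutual
  induce-noLeaves : ∀ t → induce t (noLeaves t) ≡ nothing
  induce-noLeaves (node [])       = refl
  induce-noLeaves (node (t ∷ ts)) rewrite induceAll-noLeaves (t ∷ ts) = refl

  induceAll-noLeaves : ∀ ts → induceAll ts (noLeavesAll ts) ≡ []
  induceAll-noLeaves []       = refl
  induceAll-noLeaves (t ∷ ts) rewrite induce-noLeaves t = induceAll-noLeaves ts

joinInduced : Maybe Tree → Maybe Tree → Maybe Tree
joinInduced nothing  v        = v
joinInduced (just u) nothing  = just u
joinInduced (just u) (just v) = just (branch u v)

induce-branch : ∀ a b (s : LeafSet a) (t : LeafSet b) →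
                induce (branch a b) (sub (s ∷ t ∷ [])) ≡ joinInduced (induce a s) (induce b t)
induce-branch a b s t with induce a s
... | nothing with induce b t
...   | nothing = refl
...   | just v  = refl
induce-branch a b s t | just u with induce b t
...   | nothing = refl
...   | just v  = refl

LeafInduced-branch⁺ˡ : ∀ {a b u} → LeafInduced a u → LeafInduced (branch a b) u
LeafInduced-branch⁺ˡ {a} {b} (s , s↦u) =
  sub (s ∷ noLeaves b ∷ []) ,
  trans (induce-branch a b s (noLeaves b)) (cong₂ joinInduced s↦u (induce-noLeaves b))

LeafInduced-branch⁺ : ∀ {a b u v} → LeafInduced a u → LeafInduced b v →
                      LeafInduced (branch a b) (branch u v)
LeafInduced-branch⁺ {a} {b} (s , s↦u) (t , t↦v) =
  sub (s ∷ t ∷ []) , trans (induce-branch a b s t) (cong₂ joinInduced s↦u t↦v)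

LeafInduced-branch⁻ : ∀ {a b u} → LeafInduced (branch a b) u →
                      LeafInduced a u ⊎ LeafInduced b u ⊎
                      ∃₂ λ x y → LeafInduced a x × LeafInduced b y × u ≡ branch x y
LeafInduced-branch⁻ {a} {b} (sub (s ∷ t ∷ []) , e)
  rewrite induce-branch a b s t with induce a s in s↦ | induce b t in t↦
LeafInduced-branch⁻ (sub (s ∷ t ∷ []) , ())   | nothing | nothing
LeafInduced-branch⁻ (sub (s ∷ t ∷ []) , refl) | nothing | just v  = inj₂ (inj₁ (t , t↦))
LeafInduced-branch⁻ (sub (s ∷ t ∷ []) , refl) | just u  | nothing = inj₁ (s , s↦)
LeafInduced-branch⁻ (sub (s ∷ t ∷ []) , refl) | just u  | just v  =
  inj₂ (inj₂ (u , v , (s , s↦) , (t , t↦) , refl))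

-- reps n has one tree per class of leaf-induced subtrees of f n, and fresh n
-- lists the classes of f (n+1) absent from f n. A class new in f (n+3) is a
-- branch on a class new in f (n+2) and one of f (n+1), or on two classes new in
-- f (n+1): every other such pair already occurs in f (n+2).
mutual
  reps : ℕ → List Tree
  reps zero    = leaf ∷ []
  reps (suc n) = reps n ++ fresh n

  fresh : ℕ → List Tree
  fresh zero          = cherry ∷ []
  fresh (suc zero)    = branch cherry leaf ∷ []
  fresh (suc (suc n)) = cartesianProductWith branch (fresh (suc n)) (reps (suc n)) ++ triangle (fresh n)

reps⊆reps-suc : ∀ n {x} → x ∈ reps n → x ∈ reps (suc n)
reps⊆reps-suc n = ∈-++⁺ˡ

fresh⊆reps-suc : ∀ n {x} → x ∈ fresh n → x ∈ reps (suc n)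
fresh⊆reps-suc n = ∈-++⁺ʳ (reps n)

BranchOf : List Tree → List Tree → Tree → Set
BranchOf L M x = ∃₂ λ p q → p ∈ L × q ∈ M × x ≡ branch p q

fresh-branch : ∀ n {x} → x ∈ fresh (suc n) → BranchOf (reps (suc n)) (reps n) x
fresh-branch zero    (here refl) = cherry , leaf , there (here refl) , here refl , refl
fresh-branch (suc n) x∈ with ∈-++⁻ (cartesianProductWith branch (fresh (suc n)) (reps (suc n))) x∈
... | inj₁ x∈prod with ∈-cartesianProductWith⁻ branch (fresh (suc n)) (reps (suc n)) x∈prod
...   | a , b , a∈ , b∈ , refl = a , b , fresh⊆reps-suc (suc n) a∈ , b∈ , refl
fresh-branch (suc n) x∈ | inj₂ x∈tri with ∈-triangle⁻ (fresh n) x∈tri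
...   | c , d , c∈ , d∈ , refl =
  c , d , reps⊆reps-suc (suc n) (fresh⊆reps-suc n c∈) , fresh⊆reps-suc n d∈ , refl

reps-shape : ∀ n {x} → x ∈ reps (suc (suc n)) → x ≡ leaf ⊎ BranchOf (reps (suc n)) (reps n) x
reps-shape n x∈ with ∈-++⁻ (reps (suc n)) x∈
... | inj₂ x∈fresh = inj₂ (fresh-branch n x∈fresh)
reps-shape zero x∈ | inj₁ (here refl)         = inj₁ refl
reps-shape zero x∈ | inj₁ (there (here refl)) = inj₂ (leaf , leaf , here refl , here refl , refl)
reps-shape (suc n) x∈ | inj₁ x∈reps with reps-shape n x∈reps
... | inj₁ refl                      = inj₁ refl
... | inj₂ (p , q , p∈ , q∈ , refl) = inj₂ (p , q , reps⊆reps-suc (suc n) p∈ , reps⊆reps-suc n q∈ , refl)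

branch∈reps : ∀ n {p q} → p ∈ reps (suc n) → q ∈ reps n →
              branch p q ∈ reps (suc (suc n)) ⊎ branch q p ∈ reps (suc (suc n))
branch∈reps zero (here refl)         (here refl) = inj₁ (there (here refl))
branch∈reps zero (there (here refl)) (here refl) = inj₁ (there (there (here refl)))
branch∈reps (suc n) p∈ q∈ with ∈-++⁻ (reps (suc n)) p∈
... | inj₂ p∈fresh =
  inj₁ (fresh⊆reps-suc (suc (suc n)) (∈-++⁺ˡ (∈-cartesianProductWith⁺ branch p∈fresh q∈)))
... | inj₁ p∈reps with ∈-++⁻ (reps n) q∈
...   | inj₁ q∈reps =
  Sum.map (reps⊆reps-suc (suc (suc n))) (reps⊆reps-suc (suc (suc n))) (branch∈reps n p∈reps q∈reps)
...   | inj₂ q∈fresh with ∈-++⁻ (reps n) p∈reps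
...     | inj₁ p∈reps′ =
  -- q is new in f (n+1) and p occurs in f n: the induction applies with the roles swapped
  Sum.swap (Sum.map (reps⊆reps-suc (suc (suc n))) (reps⊆reps-suc (suc (suc n)))
                    (branch∈reps n (fresh⊆reps-suc n q∈fresh) p∈reps′))
...     | inj₂ p∈fresh′ = Sum.map new new (∈-triangle⁺ (fresh n) p∈fresh′ q∈fresh)
  where
  new : ∀ {x} → x ∈ triangle (fresh n) → x ∈ reps (suc (suc (suc n)))
  new x∈ = fresh⊆reps-suc (suc (suc n))
             (∈-++⁺ʳ (cartesianProductWith branch (fresh (suc n)) (reps (suc n))) x∈)

reps-distinct-step : ∀ n → Distinct (reps (suc (suc n))) → Distinct (reps (suc n)) →
                     Distinct (reps (suc (suc (suc n))))
reps-distinct-step n d₂ d₁ = AllPairs-++⁺ d₂ distinct-fresh old#new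
  where
  fresh₂#old : ∀ {x y} → x ∈ fresh (suc n) → y ∈ reps (suc n) → x # y
  fresh₂#old x∈ y∈ = #-sym (AllPairs-++⁻-across (reps (suc n)) d₂ y∈ x∈)

  old#fresh₁ : ∀ {x y} → x ∈ reps n → y ∈ fresh n → x # y
  old#fresh₁ = AllPairs-++⁻-across (reps n) d₁

  across : ∀ {x y} → x ∈ cartesianProductWith branch (fresh (suc n)) (reps (suc n)) →
           y ∈ triangle (fresh n) → x # y
  across x∈ y∈ with ∈-cartesianProductWith⁻ branch (fresh (suc n)) (reps (suc n)) x∈
                  | ∈-triangle⁻ (fresh n) y∈
  ... | _ , _ , a∈ , _ , refl | _ , _ , c∈ , d∈ , refl =
    #-branchˡ (fresh₂#old a∈ (fresh⊆reps-suc n c∈)) (fresh₂#old a∈ (fresh⊆reps-suc n d∈))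

  distinct-fresh : Distinct (fresh (suc (suc n)))
  distinct-fresh =
    AllPairs-++⁺ (Distinct-cartesian (fresh (suc n)) (AllPairs-++⁻ʳ (reps (suc n)) d₂) d₁ fresh₂#old)
                 (Distinct-triangle (fresh n) (AllPairs-++⁻ʳ (reps n) d₁))
                 across

  old#new : ∀ {x y} → x ∈ reps (suc (suc n)) → y ∈ fresh (suc (suc n)) → x # y
  old#new x∈ y∈ with reps-shape n x∈
  ... | inj₁ refl with fresh-branch (suc n) y∈
  ...   | _ , _ , _ , _ , refl = leaf#branch
  old#new x∈ y∈ | inj₂ (_ , _ , p∈ , q∈ , refl)
    with ∈-++⁻ (cartesianProductWith branch (fresh (suc n)) (reps (suc n))) y∈
  ... | inj₁ y∈prod with ∈-cartesianProductWith⁻ branch (fresh (suc n)) (reps (suc n)) y∈prod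
  ...   | _ , _ , a∈ , _ , refl =
    #-sym (#-branchˡ (fresh₂#old a∈ p∈) (fresh₂#old a∈ (reps⊆reps-suc n q∈)))
  old#new x∈ y∈ | inj₂ (_ , _ , p∈ , q∈ , refl) | inj₂ y∈tri with ∈-triangle⁻ (fresh n) y∈tri
  ...   | _ , _ , c∈ , d∈ , refl = #-branchʳ (old#fresh₁ q∈ c∈) (old#fresh₁ q∈ d∈)

reps-distinct : ∀ n → Distinct (reps n)
reps-distinct zero                = [] ∷ []
reps-distinct (suc zero)          = (leaf#branch ∷ []) ∷ [] ∷ []
reps-distinct (suc (suc zero))    =
  (leaf#branch ∷ leaf#branch ∷ []) ∷ (#-branch (inj₁ leaf#branch) (inj₂ leaf#branch) ∷ []) ∷ [] ∷ []
reps-distinct (suc (suc (suc n))) = reps-distinct-step n (reps-distinct (suc (suc n))) (reps-distinct (suc n))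

reps-induced-step : ∀ n → All (LeafInduced (fib (suc n))) (reps (suc n)) →
                    All (LeafInduced (fib n)) (reps n) →
                    All (LeafInduced (fib (suc (suc n)))) (reps (suc (suc n)))
reps-induced-step n induced₁ induced₀ =
  All-++⁺ (All.map LeafInduced-branch⁺ˡ induced₁) (All.tabulate new)
  where
  new : ∀ {x} → x ∈ fresh (suc n) → LeafInduced (fib (suc (suc n))) x
  new x∈ with fresh-branch n x∈
  ... | _ , _ , p∈ , q∈ , refl = LeafInduced-branch⁺ (All.lookup induced₁ p∈) (All.lookup induced₀ q∈)

reps-induced : ∀ n → All (LeafInduced (fib n)) (reps n)
reps-induced zero          = (mark true , refl) ∷ []
reps-induced (suc zero)    =
  (sub (mark true ∷ mark false ∷ []) , refl) ∷ (sub (mark true ∷ mark true ∷ []) , refl) ∷ []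
reps-induced (suc (suc n)) = reps-induced-step n (reps-induced (suc n)) (reps-induced n)

Covers : Tree → List Tree → Set
Covers T L = ∀ u → LeafInduced T u → Any (u ≅_) L

reps-cover-step : ∀ n → Covers (fib (suc n)) (reps (suc n)) → Covers (fib n) (reps n) →
                  Covers (fib (suc (suc n))) (reps (suc (suc n)))
reps-cover-step n cover₁ cover₀ u u↤ with LeafInduced-branch⁻ u↤
... | inj₁ u↤₁        = ++⁺ˡ (cover₁ u u↤₁)
... | inj₂ (inj₁ u↤₀) = ++⁺ˡ (++⁺ˡ (cover₀ u u↤₀))
... | inj₂ (inj₂ (x , y , x↤ , y↤ , refl)) with find (cover₁ x x↤) | find (cover₀ y y↤)
...   | p , p∈ , x≅p | q , q∈ , y≅q with branch∈reps n p∈ q∈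
...     | inj₁ pq∈ = lose pq∈ (branch-≅ x≅p y≅q)
...     | inj₂ qp∈ = lose qp∈ (branch-≅-swap x≅p y≅q)

reps-cover : ∀ n → Covers (fib n) (reps n)
reps-cover zero       u (mark true , refl)                          = here (≅-refl leaf)
reps-cover (suc zero) u (sub (mark true  ∷ mark true  ∷ []) , refl) = there (here (≅-refl cherry))
reps-cover (suc zero) u (sub (mark true  ∷ mark false ∷ []) , refl) = here (≅-refl leaf)
reps-cover (suc zero) u (sub (mark false ∷ mark true  ∷ []) , refl) = here (≅-refl leaf)
reps-cover (suc (suc n)) = reps-cover-step n (reps-cover (suc n)) (reps-cover n)

length-reps-suc : ∀ n → length (reps (suc n)) ≡ length (reps n) + length (fresh n)
length-reps-suc n = length-++ (reps n)

length-fresh : ∀ n → length (fresh (suc (suc n))) ≡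
               length (fresh (suc n)) * length (reps (suc n)) + length (triangle (fresh n))
length-fresh n =
  trans (length-++ (cartesianProductWith branch (fresh (suc n)) (reps (suc n))))
        (cong (_+ length (triangle (fresh n)))
              (length-cartesianProductWith branch (fresh (suc n)) (reps (suc n))))

count-step : ∀ x e r e′ t → 2 * r ≡ 2 + x * suc x + 2 * (e * x) → 2 * t ≡ e * suc e →
             2 * (r + (e′ * (x + e) + t)) ≡ 2 + (x + e) * suc (x + e) + 2 * (e′ * (x + e))
count-step x e r e′ t count-r count-t = begin
    2 * (r + (e′ * (x + e) + t))
  ≡⟨ regroup x e r e′ t ⟩
    2 * r + 2 * t + 2 * (e′ * (x + e))
  ≡⟨ cong₂ (λ a b → a + b + 2 * (e′ * (x + e))) count-r count-t ⟩
    2 + x * suc x + 2 * (e * x) + e * suc e + 2 * (e′ * (x + e))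
  ≡⟨ square x e e′ ⟩
    2 + (x + e) * suc (x + e) + 2 * (e′ * (x + e)) ∎
  where
  open ≡-Reasoning
  regroup : ∀ x e r e′ t → 2 * (r + (e′ * (x + e) + t)) ≡ 2 * r + 2 * t + 2 * (e′ * (x + e))
  regroup = solve-∀
  square : ∀ x e e′ → 2 + x * suc x + 2 * (e * x) + e * suc e + 2 * (e′ * (x + e))
                      ≡ 2 + (x + e) * suc (x + e) + 2 * (e′ * (x + e))
  square = solve-∀

length-reps : ∀ n → 2 * length (reps (suc (suc n))) ≡
              2 + length (reps n) * suc (length (reps n)) + 2 * (length (fresh n) * length (reps n))
length-reps zero = refl
length-reps (suc n)
  rewrite length-reps-suc (suc (suc n)) | length-fresh n | length-reps-suc n =
  count-step (length (reps n)) (length (fresh n)) (length (reps (suc (suc n))))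
             (length (fresh (suc n))) (length (triangle (fresh n)))
             (length-reps n) (length-triangle (fresh n))

recurrence : ∀ m → let N = λ n → length (reps n) in
             2 * N (suc (suc m)) + N m * N m ≡ 2 + N m + 2 * (N m * N (suc m))
recurrence m rewrite length-reps m | length-reps-suc m = rearrange (length (reps m)) (length (fresh m))
  where
  rearrange : ∀ x e → 2 + x * suc x + 2 * (e * x) + x * x ≡ 2 + x + 2 * (x * (x + e))
  rearrange = solve-∀

reps-numClasses : ∀ n → NumClasses (fib n) (length (reps n))
reps-numClasses n =
  reps n , refl , reps-induced n , AllPairs.map proj₁ (reps-distinct n) , reps-cover n

mainTheorem2 : Σ (ℕ → ℕ) λ N →
    (∀ n → NumClasses (fib n) (N n)) ×
    (N 0 ≡ 1) × (N 1 ≡ 2) ×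
    (∀ m → 2 * N (suc (suc m)) + N m * N m ≡ 2 + N m + 2 * (N m * N (suc m)))
mainTheorem2 = (λ n → length (reps n)) , reps-numClasses , refl , refl , recurrence
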